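{- Let $G=(V,E)$ be a finite simple undirected graph and define $f:2^E\to\mathbb{R}$ by $f(W)=\mathit{tri}(E\setminus W)$. Then $f$ is submodular and non-decreasing.
   Context: For $S\subseteq E$ (the "strong" edges), an open triangle of $G$ is a wedge $u$–$v$–$w$ of distinct vertices with $(u,v),(v,w)\in E$ and $(u,w)\notin E$ (counted once, unordered in $u,w$); $T$ is the number of open triangles of $G$. An STC violation of $S$ is an open triangle $u$–$v$–$w$ with $(u,v),(v,w)\in S$; $\mathit{viol}(S)$ is the number of such violations and $\mathit{tri}(S)=T-\mathit{viol}(S)$. -}

module Defs where

open import Data.Nat using (ℕ; _+_; _∸_; _≤_; _<ᵇ_)
open import Data.Bool using (Bool; true; false; _∧_; _∨_; not; if_then_else_)
open import Data.Fin using (Fin; toℕ; _≟_)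
open import Data.List using (List; map; allFin)
open import Data.Nat.ListAction using (sum)
open import Relation.Nullary using (does)
open import Relation.Binary.PropositionalEquality using (_≡_)

record SimpleGraph (n : ℕ) : Set where
  field
    adj    : Fin n → Fin n → Bool
    sym    : ∀ u v → adj u v ≡ adj v u
    irrefl : ∀ u → adj u u ≡ false
open SimpleGraph public

-- A subset of the edge set E of G: a symmetric relation contained in adj
-- (an undirected edge {u,v} is in S iff mem u v ≡ true, equivalently mem v u ≡ true).
record EdgeSubset {n : ℕ} (G : SimpleGraph n) : Set where
  field
    mem  : Fin n → Fin n → Bool
    msym : ∀ u v → mem u v ≡ mem v u
    sub  : ∀ u v → mem u v ≡ true → adj G u v ≡ true
open EdgeSubset public

module _ {n : ℕ} {G : SimpleGraph n} where
  open Relation.Binary.PropositionalEquality using (cong₂; trans; sym)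

  allEdges : EdgeSubset G
  allEdges = record { mem = adj G ; msym = SimpleGraph.sym G ; sub = λ _ _ p → p }

  _∪ₑ_ : EdgeSubset G → EdgeSubset G → EdgeSubset G
  A ∪ₑ B = record
    { mem  = λ u v → mem A u v ∨ mem B u v
    ; msym = λ u v → cong₂ _∨_ (msym A u v) (msym B u v)
    ; sub  = λ u v → lemma u v (mem A u v) (mem B u v) Relation.Binary.PropositionalEquality.refl Relation.Binary.PropositionalEquality.refl }
    where
    lemma : ∀ u v a b → mem A u v ≡ a → mem B u v ≡ b → a ∨ b ≡ true → adj G u v ≡ true
    lemma u v true  b p _ _ = sub A u v p
    lemma u v false true _ q _ = sub B u v q

  _∩ₑ_ : EdgeSubset G → EdgeSubset G → EdgeSubset G
  A ∩ₑ B = record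
    { mem  = λ u v → mem A u v ∧ mem B u v
    ; msym = λ u v → cong₂ _∧_ (msym A u v) (msym B u v)
    ; sub  = λ u v → lemma u v (mem A u v) Relation.Binary.PropositionalEquality.refl }
    where
    lemma : ∀ u v a → mem A u v ≡ a → a ∧ mem B u v ≡ true → adj G u v ≡ true
    lemma u v true p _ = sub A u v p

  complementₑ : EdgeSubset G → EdgeSubset G
  complementₑ W = record
    { mem  = λ u v → adj G u v ∧ not (mem W u v)
    ; msym = λ u v → cong₂ (λ a b → a ∧ not b) (SimpleGraph.sym G u v) (msym W u v)
    ; sub  = λ u v → lemma u v (adj G u v) Relation.Binary.PropositionalEquality.refl }
    where
    lemma : ∀ u v a → adj G u v ≡ a → a ∧ not (mem W u v) ≡ true → adj G u v ≡ true
    lemma u v true p _ = p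

  _⊆ₑ_ : EdgeSubset G → EdgeSubset G → Set
  A ⊆ₑ B = ∀ u v → mem A u v ≡ true → mem B u v ≡ true

ΣFin : (n : ℕ) → (Fin n → ℕ) → ℕ
ΣFin n f = sum (map f (allFin n))

distinct : ∀ {n} → Fin n → Fin n → Bool
distinct u v = not (does (u ≟ v))

-- u–v–w is an open triangle of G (with u < w, so each unordered wedge is counted once)
isOpenTriangle : ∀ {n} (G : SimpleGraph n) → Fin n → Fin n → Fin n → Bool
isOpenTriangle G u v w =
  distinct u v ∧ distinct v w ∧ (toℕ u <ᵇ toℕ w)
  ∧ adj G u v ∧ adj G v w ∧ not (adj G u w)

countWedges : ∀ {n} (G : SimpleGraph n) → (Fin n → Fin n → Fin n → Bool) → ℕ
countWedges {n} G P =
  ΣFin n λ u → ΣFin n λ v → ΣFin n λ w →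
    if isOpenTriangle G u v w ∧ P u v w then 1 else 0

openTriangles : ∀ {n} (G : SimpleGraph n) → ℕ
openTriangles G = countWedges G (λ _ _ _ → true)

viol : ∀ {n} {G : SimpleGraph n} → EdgeSubset G → ℕ
viol {G = G} S = countWedges G (λ u v w → mem S u v ∧ mem S v w)

-- tri(S) = T − viol(S)   (viol(S) ≤ T, so truncated subtraction is exact)
tri : ∀ {n} {G : SimpleGraph n} → EdgeSubset G → ℕ
tri {G = G} S = openTriangles G ∸ viol S

fTri : ∀ {n} (G : SimpleGraph n) → EdgeSubset G → ℕ
fTri G W = tri (complementₑ W)

Submodular : ∀ {n} (G : SimpleGraph n) → (EdgeSubset G → ℕ) → Set
Submodular G f = ∀ (A B : EdgeSubset G) → f (A ∪ₑ B) + f (A ∩ₑ B) ≤ f A + f B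

NonDecreasing : ∀ {n} (G : SimpleGraph n) → (EdgeSubset G → ℕ) → Set
NonDecreasing G f = ∀ (A B : EdgeSubset G) → A ⊆ₑ B → f A ≤ f B

module Submission where

-- Every wedge edge of an open triangle lies in E, so an open
-- triangle u–v–w is a violation of E ∖ W exactly when neither (u,v) nor
-- (v,w) lies in W.  Hence tri(E ∖ W) = T − viol(E ∖ W) counts the open
-- triangles that W "hits", i.e. those with (u,v) ∈ W or (v,w) ∈ W:
--
--     f(W) = #{ open triangles hit by W }.
--
-- Counting open triangles that satisfy a Boolean predicate is a modular,
-- monotone function of the predicate (inclusion–exclusion for a single
-- indicator, summed over all triples).  Since being hit is monotone in W,
-- a triangle hit by A ∪ B is hit by A or by B, and one hit by A ∩ B is hit
-- by both, monotonicity and submodularity of f follow.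

open import Defs hiding (sym)
open import Data.Nat using (ℕ; _+_; _∸_; _≤_; _<ᵇ_; z≤n)
open import Data.Nat.Properties
  using (≤-refl; +-mono-≤; m+n∸n≡m; +-commutativeSemigroup; module ≤-Reasoning)
open import Algebra.Properties.CommutativeSemigroup +-commutativeSemigroup using (interchange)
open import Data.Bool using (Bool; true; false; _∧_; _∨_; not; if_then_else_)
open import Data.Bool.Properties using (∨-zeroʳ)
open import Data.Fin using (Fin; toℕ)
open import Data.List using (List; []; _∷_; map; allFin)
open import Data.Nat.ListAction using (sum)
open import Data.Product using (_×_; _,_)
open import Relation.Binary.PropositionalEquality
  using (_≡_; refl; sym; trans; cong; cong₂; subst₂; module ≡-Reasoning)

ind : Bool → ℕ
ind b = if b then 1 else 0

sum-map-+ : ∀ {A : Set} (f g : A → ℕ) (xs : List A) →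
  sum (map (λ x → f x + g x) xs) ≡ sum (map f xs) + sum (map g xs)
sum-map-+ f g []       = refl
sum-map-+ f g (x ∷ xs) = trans (cong (f x + g x +_) (sum-map-+ f g xs))
                               (interchange (f x) (g x) (sum (map f xs)) (sum (map g xs)))

sum-map-mono : ∀ {A : Set} {f g : A → ℕ} → (∀ x → f x ≤ g x) →
  (xs : List A) → sum (map f xs) ≤ sum (map g xs)
sum-map-mono f≤g []       = ≤-refl
sum-map-mono f≤g (x ∷ xs) = +-mono-≤ (f≤g x) (sum-map-mono f≤g xs)

sum-map-cong : ∀ {A : Set} {f g : A → ℕ} → (∀ x → f x ≡ g x) →
  (xs : List A) → sum (map f xs) ≡ sum (map g xs)
sum-map-cong f≡g []       = refl
sum-map-cong f≡g (x ∷ xs) = cong₂ _+_ (f≡g x) (sum-map-cong f≡g xs)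

Σ³ : (n : ℕ) → (Fin n → Fin n → Fin n → ℕ) → ℕ
Σ³ n h = ΣFin n λ u → ΣFin n λ v → ΣFin n λ w → h u v w

Σ³-+ : ∀ n (f g : Fin n → Fin n → Fin n → ℕ) →
  Σ³ n (λ u v w → f u v w + g u v w) ≡ Σ³ n f + Σ³ n g
Σ³-+ n f g =
  trans (sum-map-cong (λ u →
    trans (sum-map-cong (λ v → sum-map-+ (f u v) (g u v) (allFin n)) (allFin n))
          (sum-map-+ _ _ (allFin n))) (allFin n))
        (sum-map-+ _ _ (allFin n))

Σ³-mono : ∀ n {f g : Fin n → Fin n → Fin n → ℕ} →
  (∀ u v w → f u v w ≤ g u v w) → Σ³ n f ≤ Σ³ n g
Σ³-mono n f≤g =
  sum-map-mono (λ u → sum-map-mono (λ v → sum-map-mono (f≤g u v) (allFin n)) (allFin n)) (allFin n)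

Σ³-cong : ∀ n {f g : Fin n → Fin n → Fin n → ℕ} →
  (∀ u v w → f u v w ≡ g u v w) → Σ³ n f ≡ Σ³ n g
Σ³-cong n f≡g =
  sum-map-cong (λ u → sum-map-cong (λ v → sum-map-cong (f≡g u v) (allFin n)) (allFin n)) (allFin n)

Pred³ : ℕ → Set
Pred³ n = Fin n → Fin n → Fin n → Bool

_⇒³_ : ∀ {n} → Pred³ n → Pred³ n → Set
P ⇒³ Q = ∀ u v w → P u v w ≡ true → Q u v w ≡ true

ind-split : ∀ t p → ind (t ∧ p) + ind (t ∧ not p) ≡ ind (t ∧ true)
ind-split false p     = refl
ind-split true  true  = refl
ind-split true  false = refl

ind-∨∧ : ∀ t p q → ind (t ∧ (p ∨ q)) + ind (t ∧ (p ∧ q)) ≡ ind (t ∧ p) + ind (t ∧ q)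
ind-∨∧ false p     q = refl
ind-∨∧ true  true  q = refl
ind-∨∧ true  false true  = refl
ind-∨∧ true  false false = refl

ind-mono : ∀ t {p q} → (p ≡ true → q ≡ true) → ind (t ∧ p) ≤ ind (t ∧ q)
ind-mono false       p⇒q = ≤-refl
ind-mono true {false} p⇒q = z≤n
ind-mono true {true}  p⇒q rewrite p⇒q refl = ≤-refl

module Counting {n : ℕ} (G : SimpleGraph n) where

  count-split : ∀ (P : Pred³ n) →
    countWedges G P + countWedges G (λ u v w → not (P u v w)) ≡ openTriangles G
  count-split P = trans (sym (Σ³-+ n _ _))
    (Σ³-cong n λ u v w → ind-split (isOpenTriangle G u v w) (P u v w))

  count-∨∧ : ∀ (P Q : Pred³ n) →
    countWedges G (λ u v w → P u v w ∨ Q u v w) + countWedges G (λ u v w → P u v w ∧ Q u v w)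
      ≡ countWedges G P + countWedges G Q
  count-∨∧ P Q = trans (sym (Σ³-+ n _ _)) (trans
    (Σ³-cong n λ u v w → ind-∨∧ (isOpenTriangle G u v w) (P u v w) (Q u v w))
    (Σ³-+ n _ _))

  count-mono : ∀ {P Q : Pred³ n} → P ⇒³ Q → countWedges G P ≤ countWedges G Q
  count-mono P⇒Q = Σ³-mono n λ u v w → ind-mono (isOpenTriangle G u v w) (P⇒Q u v w)

  count-cong : ∀ {P Q : Pred³ n} →
    (∀ u v w → isOpenTriangle G u v w ≡ true → P u v w ≡ Q u v w) →
    countWedges G P ≡ countWedges G Q
  count-cong {P} {Q} agree = Σ³-cong n λ u v w → pointwise u v w (isOpenTriangle G u v w) refl
    where
    pointwise : ∀ u v w t → isOpenTriangle G u v w ≡ t → ind (t ∧ P u v w) ≡ ind (t ∧ Q u v w)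
    pointwise u v w false _      = refl
    pointwise u v w true  isOpen = cong ind (agree u v w isOpen)

∧-trueˡ : ∀ a {b} → a ∧ b ≡ true → a ≡ true
∧-trueˡ true _ = refl

∧-trueʳ : ∀ a {b} → a ∧ b ≡ true → b ≡ true
∧-trueʳ true b≡true = b≡true

wedge-edges : ∀ {n} (G : SimpleGraph n) u v w → isOpenTriangle G u v w ≡ true →
  adj G u v ≡ true × adj G v w ≡ true
wedge-edges G u v w isOpen = ∧-trueˡ (adj G u v) edges , ∧-trueˡ (adj G v w) (∧-trueʳ (adj G u v) edges)
  where
  edges : adj G u v ∧ adj G v w ∧ not (adj G u w) ≡ true
  edges = ∧-trueʳ (toℕ u <ᵇ toℕ w) (∧-trueʳ (distinct v w) (∧-trueʳ (distinct u v) isOpen))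

hit : ∀ {n} {G : SimpleGraph n} → EdgeSubset G → Pred³ n
hit W u v w = mem W u v ∨ mem W v w

fTri≡hits : ∀ {n} (G : SimpleGraph n) (W : EdgeSubset G) → fTri G W ≡ countWedges G (hit W)
fTri≡hits {n} G W = begin
  openTriangles G ∸ viol (complementₑ W)              ≡⟨ cong (openTriangles G ∸_) violation≡unhit ⟩
  openTriangles G ∸ countWedges G unhit               ≡⟨ cong (_∸ countWedges G unhit) (sym (count-split (hit W))) ⟩
  countWedges G (hit W) + countWedges G unhit ∸ countWedges G unhit
                                                      ≡⟨ m+n∸n≡m (countWedges G (hit W)) (countWedges G unhit) ⟩
  countWedges G (hit W)                               ∎
  where
  open ≡-Reasoning
  open Counting G

  unhit : Pred³ n
  unhit u v w = not (hit W u v w)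

  -- De Morgan, once both wedge edges are known to be in E.
  violation-on-open : ∀ u v w → isOpenTriangle G u v w ≡ true →
    (adj G u v ∧ not (mem W u v)) ∧ (adj G v w ∧ not (mem W v w)) ≡ unhit u v w
  violation-on-open u v w isOpen with wedge-edges G u v w isOpen
  ... | uv , vw rewrite uv | vw with mem W u v
  ...   | true  = refl
  ...   | false = refl

  violation≡unhit : viol (complementₑ W) ≡ countWedges G unhit
  violation≡unhit = count-cong violation-on-open

hit-mono : ∀ {n} {G : SimpleGraph n} {A B : EdgeSubset G} → A ⊆ₑ B → hit A ⇒³ hit B
hit-mono {A = A} {B} A⊆B u v w h with mem A u v in uv
... | true  rewrite A⊆B u v uv = refl
... | false rewrite A⊆B v w h  = ∨-zeroʳ (mem B u v)

hit-∪ : ∀ {n} {G : SimpleGraph n} (A B : EdgeSubset G) →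
  hit (A ∪ₑ B) ⇒³ (λ u v w → hit A u v w ∨ hit B u v w)
hit-∪ A B u v w = reassociate (mem A u v) (mem B u v) (mem A v w) (mem B v w)
  where
  reassociate : ∀ a b c d → (a ∨ b) ∨ (c ∨ d) ≡ true → (a ∨ c) ∨ (b ∨ d) ≡ true
  reassociate true  b     c     d     _ = refl
  reassociate false true  c     d     _ = ∨-zeroʳ c
  reassociate false false true  d     _ = refl
  reassociate false false false d     h = h

hit-∩ : ∀ {n} {G : SimpleGraph n} (A B : EdgeSubset G) →
  hit (A ∩ₑ B) ⇒³ (λ u v w → hit A u v w ∧ hit B u v w)
hit-∩ A B u v w = distribute (mem A u v) (mem B u v) (mem A v w) (mem B v w)
  where
  distribute : ∀ a b c d → (a ∧ b) ∨ (c ∧ d) ≡ true → (a ∨ c) ∧ (b ∨ d) ≡ true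
  distribute true  true  c     d     _ = refl
  distribute true  false true  true  _ = refl
  distribute true  false true  false ()
  distribute true  false false d     ()
  distribute false b     true  true  _ = ∨-zeroʳ b
  distribute false b     true  false ()
  distribute false b     false d     ()

proposition4p1 : ∀ {n : ℕ} (G : SimpleGraph n) →
    Submodular G (fTri G) × NonDecreasing G (fTri G)
proposition4p1 G = submodular , nonDecreasing
  where
  open Counting G

  submodular : Submodular G (fTri G)
  submodular A B = begin
    fTri G (A ∪ₑ B) + fTri G (A ∩ₑ B)
      ≡⟨ cong₂ _+_ (fTri≡hits G (A ∪ₑ B)) (fTri≡hits G (A ∩ₑ B)) ⟩
    countWedges G (hit (A ∪ₑ B)) + countWedges G (hit (A ∩ₑ B))
      ≤⟨ +-mono-≤ (count-mono (hit-∪ A B)) (count-mono (hit-∩ A B)) ⟩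
    countWedges G (λ u v w → hit A u v w ∨ hit B u v w)
      + countWedges G (λ u v w → hit A u v w ∧ hit B u v w)
      ≡⟨ count-∨∧ (hit A) (hit B) ⟩
    countWedges G (hit A) + countWedges G (hit B)
      ≡⟨ sym (cong₂ _+_ (fTri≡hits G A) (fTri≡hits G B)) ⟩
    fTri G A + fTri G B ∎
    where open ≤-Reasoning

  nonDecreasing : NonDecreasing G (fTri G)
  nonDecreasing A B A⊆B =
    subst₂ _≤_ (sym (fTri≡hits G A)) (sym (fTri≡hits G B)) (count-mono (hit-mono {A = A} {B} A⊆B))
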